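{- For every finite set $X$, the linear map $\Gamma:\mathbb T_X\to\mathbb T_X\otimes\mathbb T_X$ defined on topologies $\mathcal T$ on $X$ by $$\Gamma(\mathcal T)=\sum_{\mathcal T'\ \mathcal T\text{ -admissible}}\mathcal T'\otimes\mathcal T/\mathcal T'$$ is coassociative: $(\Gamma\otimes\mathrm{Id})\Gamma=(\mathrm{Id}\otimes\Gamma)\Gamma$.
   Context: For a finite set $X$, $\mathbb T_X$ denotes the vector space (over a field $K$) freely generated by the topologies on $X$. For a topology $\mathcal T$ on $X$, $x\le_{\mathcal T}y$ iff every open set containing $x$ contains $y$ (topologies correspond bijectively to quasi-orders, open sets being final segments); $x\sim_{\mathcal T}y$ iff $x\le_{\mathcal T}y$ and $y\le_{\mathcal T}x$. Write $\mathcal T'\prec\mathcal T$ when every $\mathcal T$-open set is $\mathcal T'$-open. For $\mathcal T'\prec\mathcal T$, $\mathcal T/\mathcal T'$ is the topology on $X$ whose quasi-order is the transitive closure of $x\,\mathcal R\,y\iff(x\le_{\mathcal T}y\text{ or }y\le_{\mathcal T'}x)$. For $Y\subset X$, $\mathcal T|_Y=\{Z\cap Y:Z\in\mathcal T\}$; $Y$ is $\mathcal T$-connected if $(Y,\mathcal T|_Y)$ is connected. $\mathcal T'$ is $\mathcal T$-admissible if $\mathcal T'\prec\mathcal T$, $\mathcal T'|_Y=\mathcal T|_Y$ for every $\mathcal T'$-connected $Y\subset X$, and $x\sim_{\mathcal T/\mathcal T'}y\iff x\sim_{\mathcal T'/\mathcal T'}y$ for all $x,y$. -}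

module Defs where

open import Data.Bool using (Bool; true; false; _∨_; _∧_)
open import Data.Bool.Properties using () renaming (_≟_ to _≟B_)
open import Data.Nat using (ℕ; zero; suc)
open import Data.Fin using (Fin)
open import Data.Fin.Properties using (all?; any?)
open import Data.Fin.Subset using (Subset; _∈_; _∩_; _∪_; ⊥; Nonempty)
open import Data.Fin.Subset.Properties using (_∈?_; anySubset?)
open import Data.Vec using (Vec; []; _∷_; lookup; tabulate)
import Data.Vec.Properties as VecP
open import Data.List using (List; []; _∷_; [_]; map; concatMap; filter; allFin)
open import Data.Bool.ListAction using (any)
open import Data.Product using (Σ; ∃; _×_; _,_)
open import Relation.Nullary using (¬_; Dec; yes; no)
open import Relation.Nullary.Decidable using (_×-dec_; _→-dec_; ¬?; map′)
open import Relation.Binary.PropositionalEquality using (_≡_; refl)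

-- X = Fin n.  A topology on X is represented by its quasi-order
-- (specialisation order), stored as a Boolean matrix:
-- lookup (lookup T x) y = true  iff  x ≤_T y.

QO : ℕ → Set
QO n = Vec (Vec Bool n) n

le : ∀ {n} → QO n → Fin n → Fin n → Bool
le T x y = lookup (lookup T x) y

_≤[_]_ : ∀ {n} → Fin n → QO n → Fin n → Set
x ≤[ T ] y = le T x y ≡ true

_∼[_]_ : ∀ {n} → Fin n → QO n → Fin n → Set
x ∼[ T ] y = (x ≤[ T ] y) × (y ≤[ T ] x)

IsTopology : ∀ {n} → QO n → Set
IsTopology {n} T =
  (∀ (x : Fin n) → x ≤[ T ] x) ×
  (∀ (x y z : Fin n) → x ≤[ T ] y → y ≤[ T ] z → x ≤[ T ] z)

IsOpen : ∀ {n} → QO n → Subset n → Set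
IsOpen {n} T U = ∀ (x y : Fin n) → x ∈ U → x ≤[ T ] y → y ∈ U

_≺_ : ∀ {n} → QO n → QO n → Set
_≺_ {n} T' T = ∀ (U : Subset n) → IsOpen T U → IsOpen T' U

InRestr : ∀ {n} → QO n → Subset n → Subset n → Set
InRestr T Y W = ∃ λ Z → IsOpen T Z × (Z ∩ Y ≡ W)

_⟺_ : Set → Set → Set
A ⟺ B = (A → B) × (B → A)

SameRestr : ∀ {n} → QO n → QO n → Subset n → Set
SameRestr {n} T' T Y = ∀ (W : Subset n) → InRestr T' Y W ⟺ InRestr T Y W

Connected : ∀ {n} → QO n → Subset n → Set
Connected {n} T Y = ¬ (Σ (Subset n) λ U → Σ (Subset n) λ V →
  InRestr T Y U × InRestr T Y V × Nonempty U × Nonempty V ×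
  (U ∩ V ≡ ⊥) × (U ∪ V ≡ Y))

-- T / T' : the quasi-order which is the transitive closure of
-- x R y  iff  (x ≤_T y or y ≤_T' x).
-- reach R k x y = there is an R-path from x to y with at most k+1 steps;
-- on an n-element set, reach R n is the transitive closure of R.
reach : ∀ {n} → (Fin n → Fin n → Bool) → ℕ → Fin n → Fin n → Bool
reach R zero x y = R x y
reach {n} R (suc k) x y =
  reach R k x y ∨ any (λ z → reach R k x z ∧ R z y) (allFin n)

quotR : ∀ {n} → QO n → QO n → Fin n → Fin n → Bool
quotR T T' x y = le T x y ∨ le T' y x

_/_ : ∀ {n} → QO n → QO n → QO n
_/_ {n} T T' = tabulate λ x → tabulate λ y → reach (quotR T T') n x y

Admissible : ∀ {n} → QO n → QO n → Set
Admissible {n} T T' =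
  (T' ≺ T) ×
  (∀ (Y : Subset n) → Connected T' Y → SameRestr T' T Y) ×
  (∀ (x y : Fin n) → (x ∼[ T / T' ] y) ⟺ (x ∼[ T' / T' ] y))

allSubset? : ∀ {n} {P : Subset n → Set} → (∀ U → Dec (P U)) → Dec (∀ U → P U)
allSubset? {P = P} P? with anySubset? (λ U → ¬? (P? U))
... | yes (U , ¬p) = no λ h → ¬p (h U)
... | no ¬∃ = yes λ U → dec-stable (P? U) λ ¬p → ¬∃ (U , ¬p)
  where
  dec-stable : ∀ {A : Set} → Dec A → ¬ ¬ A → A
  dec-stable (yes a) _ = a
  dec-stable (no ¬a) h with h ¬a
  ... | ()

_⟺?_ : ∀ {A B : Set} → Dec A → Dec B → Dec (A ⟺ B)
a ⟺? b = (a →-dec b) ×-dec (b →-dec a)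

≤? : ∀ {n} (T : QO n) x y → Dec (x ≤[ T ] y)
≤? T x y = le T x y ≟B true

∼? : ∀ {n} (T : QO n) x y → Dec (x ∼[ T ] y)
∼? T x y = ≤? T x y ×-dec ≤? T y x

≡S? : ∀ {n} (U V : Subset n) → Dec (U ≡ V)
≡S? = VecP.≡-dec _≟B_

isTopology? : ∀ {n} (T : QO n) → Dec (IsTopology T)
isTopology? T = all? (λ x → ≤? T x x) ×-dec
  all? (λ x → all? λ y → all? λ z → ≤? T x y →-dec (≤? T y z →-dec ≤? T x z))

isOpen? : ∀ {n} (T : QO n) U → Dec (IsOpen T U)
isOpen? T U = all? λ x → all? λ y → (x ∈? U) →-dec (≤? T x y →-dec (y ∈? U))

≺? : ∀ {n} (T' T : QO n) → Dec (T' ≺ T)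
≺? T' T = allSubset? λ U → isOpen? T U →-dec isOpen? T' U

inRestr? : ∀ {n} (T : QO n) Y W → Dec (InRestr T Y W)
inRestr? T Y W = anySubset? λ Z → isOpen? T Z ×-dec ≡S? (Z ∩ Y) W

nonempty? : ∀ {n} (U : Subset n) → Dec (Nonempty U)
nonempty? U = any? λ x → x ∈? U

connected? : ∀ {n} (T : QO n) Y → Dec (Connected T Y)
connected? T Y = ¬? (anySubset? λ U → anySubset? λ V →
  inRestr? T Y U ×-dec inRestr? T Y V ×-dec nonempty? U ×-dec
  nonempty? V ×-dec ≡S? (U ∩ V) ⊥ ×-dec ≡S? (U ∪ V) Y)

admissible? : ∀ {n} (T T' : QO n) → Dec (Admissible T T')
admissible? T T' =
  ≺? T' T ×-dec
  (allSubset? λ Y → connected? T' Y →-dec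
     (allSubset? λ W → inRestr? T' Y W ⟺? inRestr? T Y W)) ×-dec
  (all? λ x → all? λ y → ∼? (T / T') x y ⟺? ∼? (T' / T') x y)

allVecs : ∀ {A : Set} (k : ℕ) → List A → List (Vec A k)
allVecs zero xs = [ [] ]
allVecs (suc k) xs = concatMap (λ x → map (x ∷_) (allVecs k xs)) xs

allMatrices : ∀ n → List (QO n)
allMatrices n = allVecs n (allVecs n (true ∷ false ∷ []))

Topologies : ∀ n → List (QO n)
Topologies n = filter isTopology? (allMatrices n)

-- Elements of T_X, T_X ⊗ T_X, T_X ⊗ T_X ⊗ T_X with nonnegative integer
-- coefficients are represented as lists (formal sums) of basis
-- elements (topologies, resp. pairs / triples of topologies);
-- two such formal sums are equal iff the lists are permutations.

Γ : ∀ {n} → QO n → List (QO n × QO n)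
Γ {n} T = map (λ T' → (T' , T / T')) (filter (admissible? T) (Topologies n))

ΓId∘Γ : ∀ {n} → QO n → List (QO n × QO n × QO n)
ΓId∘Γ T = concatMap (λ { (A , B) → map (λ { (a , b) → (a , b , B) }) (Γ A) }) (Γ T)

IdΓ∘Γ : ∀ {n} → QO n → List (QO n × QO n × QO n)
IdΓ∘Γ T = concatMap (λ { (A , B) → map (λ { (b , c) → (A , b , c) }) (Γ B) }) (Γ T)

-- A T-admissible T′ is described order-theoretically: T′ ⊆ T, the two quasi-orders agree on every
-- T′-component, and the classes of T / T′ are exactly the T′-components.  A summand a ⊗ A/a ⊗ T/A of (Γ ⊗ Id) Γ T (A T-admissible,
-- a A-admissible) is a summand of (Id ⊗ Γ) Γ T, because a is T-admissible, A/a is T/a-admissible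
-- and (T/a)/(A/a) = T/A.  Conversely, for a summand C ⊗ D ⊗ (T/C)/D of (Id ⊗ Γ) Γ T, the restriction
-- A of T to the D-components is T-admissible, C is A-admissible, A/C = D and T/A = (T/C)/D.
-- Finally both sums have no repeated terms, since a T-admissible A is determined by T / A, so
-- having the same terms makes the two lists permutations of each other.
module Submission where

open import Defs
open import Data.Bool using (Bool; true; false; _∨_; _∧_)
open import Data.Bool.ListAction using (any)
open import Data.Bool.Properties using (T-≡)
open import Data.Empty using (⊥-elim)
open import Data.Fin using (Fin; _<_) renaming (_≟_ to _≟ᶠ_)
open import Data.Fin.Properties using (pigeonhole)
open import Data.Fin.Subset using (Subset; _∩_; _∪_; ∁; ⊥) renaming (_∈_ to _∈ˢ_)
open import Data.Fin.Subset.Properties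
  using (x∈p∩q⁺; p∩q⊆p; p∩q⊆q; x∈p∪q⁺; x∈p∪q⁻; ∉⊥; ⊥⊆; ⊆-antisym; x∈∁p⇒x∉p; x∉p⇒x∈∁p)
  renaming (_∈?_ to _∈ˢ?_)
open import Data.List using (List; []; _∷_; length; lookup; map; filter; concatMap; allFin)
open import Data.List.Membership.Propositional using (_∈_; find; lose)
open import Data.List.Membership.Propositional.Properties
  using (∈-allFin; ∈-lookup; ∈-map⁺; ∈-map⁻; ∈-concatMap⁺; ∈-concatMap⁻; ∈-filter⁺; ∈-filter⁻)
open import Data.List.Membership.Propositional.Properties.WithK using (unique∧set⇒bag)
open import Data.List.Relation.Binary.BagAndSetEquality using (∼bag⇒↭)
open import Data.List.Relation.Binary.Permutation.Propositional using (_↭_)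
import Data.List.Relation.Unary.All as All
open import Data.List.Relation.Unary.All.Properties using (¬Any⇒All¬)
open import Data.List.Relation.Unary.AllPairs using (_∷_)
open import Data.List.Relation.Unary.Any using (here; there)
import Data.List.Relation.Unary.Any as Any
open import Data.List.Relation.Unary.Any.Properties using (any⁺; any⁻)
open import Data.List.Relation.Unary.Unique.Propositional using (Unique; [])
import Data.List.Relation.Unary.Unique.Propositional.Properties as Unique
open import Data.Nat using (ℕ; zero; suc; _≤_; z≤n; s≤s) renaming (_≤?_ to _≤ℕ?_)
open import Data.Nat.Properties using (m≤n⇒m≤1+n; ≰⇒>)
open import Data.Product using (∃; ∃₂; _×_; _,_; proj₁; proj₂)
open import Data.Sum using (_⊎_; inj₁; inj₂; [_,_]′)
open import Data.Vec using (Vec; []; _∷_; tabulate) renaming (lookup to lookupᵛ)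
open import Data.Vec.Properties
  using (∷-injectiveˡ; ∷-injectiveʳ; lookup∘tabulate; tabulate∘lookup; tabulate-cong; []=⇒lookup; lookup⇒[]=)
open import Function using (id; _∘_)
open import Function.Bundles using (Equivalence; _⇔_; mk⇔)
open import Relation.Binary.Construct.Closure.ReflexiveTransitive
  using (Star; ε; _◅_; _◅◅_; reverse; _>>=_)
import Relation.Binary.Construct.Closure.ReflexiveTransitive as Star
open import Relation.Binary.PropositionalEquality
  using (_≡_; _≢_; refl; sym; trans; cong; subst; subst₂)
open import Relation.Nullary using (yes; no)

open Equivalence using (to; from)

∨-true⁻ : ∀ {a b} → a ∨ b ≡ true → a ≡ true ⊎ b ≡ true
∨-true⁻ {true}  _ = inj₁ refl
∨-true⁻ {false} p = inj₂ p

∨-trueˡ : ∀ {a b} → a ≡ true → a ∨ b ≡ true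
∨-trueˡ refl = refl

∨-trueʳ : ∀ {a b} → b ≡ true → a ∨ b ≡ true
∨-trueʳ {true}  _ = refl
∨-trueʳ {false} p = p

∧-true⁻ : ∀ {a b} → a ∧ b ≡ true → a ≡ true × b ≡ true
∧-true⁻ {true} p = refl , p

∧-true⁺ : ∀ {a b} → a ≡ true → b ≡ true → a ∧ b ≡ true
∧-true⁺ refl p = p

true-ext : ∀ {a b} → (a ≡ true → b ≡ true) → (b ≡ true → a ≡ true) → a ≡ b
true-ext {true}  {true}  _ _ = refl
true-ext {true}  {false} f _ = sym (f refl)
true-ext {false} {true}  _ g = g refl
true-ext {false} {false} _ _ = refl

any-true⁻ : ∀ {A : Set} (g : A → Bool) xs → any g xs ≡ true → ∃ λ z → g z ≡ true
any-true⁻ g xs p with z , _ , gz ← find (any⁻ g xs (from T-≡ p)) = z , to T-≡ gz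

any-true⁺ : ∀ {A : Set} (g : A → Bool) {xs z} → z ∈ xs → g z ≡ true → any g xs ≡ true
any-true⁺ g z∈xs gz = to T-≡ (any⁺ g (lose z∈xs (from T-≡ gz)))

Unique⇒length≤ : ∀ {n} {vs : List (Fin n)} → Unique vs → length vs ≤ n
Unique⇒length≤ {n} {vs} u with length vs ≤ℕ? n
... | yes p = p
... | no ¬p with i , j , i<j , eq ← pigeonhole (≰⇒> ¬p) (lookup vs) = ⊥-elim (distinct u i<j eq)
  where
  distinct : ∀ {vs : List (Fin n)} → Unique vs → ∀ {i j} → i < j → lookup vs i ≢ lookup vs j
  distinct (v≢ ∷ _) {Fin.zero}  {Fin.suc j} _         = All.lookup v≢ (∈-lookup j)
  distinct (_ ∷ u)  {Fin.suc i} {Fin.suc j} (s≤s i<j) = distinct u i<j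

module Reachability {n : ℕ} (f : Fin n → Fin n → Bool) where

  R : Fin n → Fin n → Set
  R x y = f x y ≡ true

  reach⇒star : ∀ k {x y} → reach f k x y ≡ true → Star R x y
  reach⇒star zero p = p ◅ ε
  reach⇒star (suc k) {x} {y} p with ∨-true⁻ {reach f k x y} p
  ... | inj₁ q = reach⇒star k q
  ... | inj₂ q with z , r ← any-true⁻ (λ z → reach f k x z ∧ f z y) (allFin n) q
                 with xz , zy ← ∧-true⁻ {reach f k x z} r
                 = reach⇒star k xz ◅◅ (zy ◅ ε)

  -- The index lists the visited vertices, the most recent first.
  data Walk (x : Fin n) : Fin n → List (Fin n) → Set where
    start : ∀ {y} → R x y → Walk x y (y ∷ [])
    _▷_   : ∀ {y z vs} → Walk x y vs → R y z → Walk x z (z ∷ vs)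

  walk⇒reach : ∀ {x y vs} → Walk x y vs → ∀ k → length vs ≤ suc k → reach f k x y ≡ true
  walk⇒reach (start r)     zero    _ = r
  walk⇒reach (start r)     (suc k) _ = ∨-trueˡ (walk⇒reach (start r) k (s≤s z≤n))
  walk⇒reach (start _ ▷ _) zero    (s≤s ())
  walk⇒reach ((_ ▷ _) ▷ _) zero    (s≤s ())
  walk⇒reach {x} {z} (_▷_ {y = y} w r) (suc k) (s≤s len≤) =
    ∨-trueʳ (any-true⁺ (λ v → reach f k x v ∧ f v z) (∈-allFin y) (∧-true⁺ (walk⇒reach w k len≤) r))

  truncate : ∀ {x y vs v} → Walk x y vs → v ∈ vs → ∃ λ ws → Walk x v ws × (Unique vs → Unique ws)
  truncate (start r) (here refl)  = _ , start r , id
  truncate (w ▷ r)   (here refl)  = _ , w ▷ r , id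
  truncate (w ▷ r)   (there v∈vs) with ws , w′ , u ← truncate w v∈vs = ws , w′ , λ { (_ ∷ uvs) → u uvs }

  SimpleWalk : Fin n → Fin n → Set
  SimpleWalk x y = ∃ λ vs → Walk x y vs × Unique vs

  -- A walk returning to a visited vertex is cut back, so no vertex is visited twice.
  extend : ∀ {x y z} → SimpleWalk x y → R y z → SimpleWalk x z
  extend {z = z} (vs , w , u) r with Any.any? (z ≟ᶠ_) vs
  ... | yes z∈vs with ws , w′ , u′ ← truncate w z∈vs = ws , w′ , u′ u
  ... | no  z∉vs = z ∷ vs , w ▷ r , ¬Any⇒All¬ vs z∉vs ∷ u

  simplify : ∀ {x y z} → SimpleWalk x y → Star R y z → SimpleWalk x z
  simplify w ε        = w
  simplify w (r ◅ rs) = simplify (extend w r) rs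

  star⇒reach : (∀ x → R x x) → ∀ {x y} → Star R x y → reach f n x y ≡ true
  star⇒reach refl-R {x} xy with vs , w , u ← simplify (x ∷ [] , start (refl-R x) , All.[] ∷ []) xy =
    walk⇒reach w n (m≤n⇒m≤1+n (Unique⇒length≤ u))

lookup-ext : ∀ {A : Set} {m} {u v : Vec A m} → (∀ i → lookupᵛ u i ≡ lookupᵛ v i) → u ≡ v
lookup-ext {u = u} {v} eq = trans (sym (tabulate∘lookup u)) (trans (tabulate-cong eq) (tabulate∘lookup v))

module _ {n : ℕ} where

  ∈-tabulate⁺ : ∀ (g : Fin n → Bool) {x} → g x ≡ true → x ∈ˢ tabulate g
  ∈-tabulate⁺ g {x} gx = lookup⇒[]= x (tabulate g) (trans (lookup∘tabulate g x) gx)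

  ∈-tabulate⁻ : ∀ (g : Fin n → Bool) {x} → x ∈ˢ tabulate g → g x ≡ true
  ∈-tabulate⁻ g {x} x∈ = trans (sym (lookup∘tabulate g x)) ([]=⇒lookup x∈)

  le-tabulate : ∀ (g : Fin n → Fin n → Bool) x y → le (tabulate λ u → tabulate (g u)) x y ≡ g x y
  le-tabulate g x y = trans (cong (λ row → lookupᵛ row y) (lookup∘tabulate _ x)) (lookup∘tabulate (g x) y)

  ≤-ext : ∀ {A B : QO n} → (∀ {x y} → x ≤[ A ] y → x ≤[ B ] y) → (∀ {x y} → x ≤[ B ] y → x ≤[ A ] y) → A ≡ B
  ≤-ext A⊆B B⊆A = lookup-ext λ x → lookup-ext λ y → true-ext A⊆B B⊆A

  data Step (T T′ : QO n) (x y : Fin n) : Set where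
    fwd : x ≤[ T ] y  → Step T T′ x y
    bwd : y ≤[ T′ ] x → Step T T′ x y

  Zigzag : QO n → QO n → Fin n → Fin n → Set
  Zigzag T T′ = Star (Step T T′)

  Linked : QO n → Fin n → Fin n → Set
  Linked T = Zigzag T T

  linked-sym : ∀ {T x y} → Linked T x y → Linked T y x
  linked-sym = reverse λ { (fwd p) → bwd p ; (bwd p) → fwd p }

  le-/ : ∀ (T T′ : QO n) x y → le (T / T′) x y ≡ reach (quotR T T′) n x y
  le-/ T T′ = le-tabulate (reach (quotR T T′) n)

  /⇒zigzag : ∀ {T T′ x y} → x ≤[ T / T′ ] y → Zigzag T T′ x y
  /⇒zigzag {T} {T′} {x} {y} p =
    Star.map toStep (Reachability.reach⇒star (quotR T T′) n (trans (sym (le-/ T T′ x y)) p))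
    where
    toStep : ∀ {a b} → quotR T T′ a b ≡ true → Step T T′ a b
    toStep {a} {b} q with ∨-true⁻ {le T a b} q
    ... | inj₁ a≤b = fwd a≤b
    ... | inj₂ b≤a = bwd b≤a

  zigzag⇒/ : ∀ {T T′} → IsTopology T → ∀ {x y} → Zigzag T T′ x y → x ≤[ T / T′ ] y
  zigzag⇒/ {T} {T′} (refl-T , _) {x} {y} xy =
    trans (le-/ T T′ x y) (Reachability.star⇒reach (quotR T T′) (∨-trueˡ ∘ refl-T) (Star.map fromStep xy))
    where
    fromStep : ∀ {a b} → Step T T′ a b → quotR T T′ a b ≡ true
    fromStep (fwd a≤b) = ∨-trueˡ a≤b
    fromStep (bwd b≤a) = ∨-trueʳ b≤a

  step⇒/ : ∀ {T T′} → IsTopology T → ∀ {x y} → Step T T′ x y → x ≤[ T / T′ ] y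
  step⇒/ tT s = zigzag⇒/ tT (s ◅ ε)

  /-isTopology : ∀ T T′ → IsTopology T → IsTopology (T / T′)
  /-isTopology T T′ tT =
    (λ _ → zigzag⇒/ {T} {T′} tT ε) , λ _ _ _ p q → zigzag⇒/ tT (/⇒zigzag {T} {T′} p ◅◅ /⇒zigzag q)

  linked⇒linked/ : ∀ {T} T′ → IsTopology T → ∀ {x y} → Linked T x y → Linked (T / T′) x y
  linked⇒linked/ {T} T′ tT = Star.map λ { (fwd p) → fwd (step⇒/ {T} {T′} tT (fwd p))
                                         ; (bwd p) → bwd (step⇒/ {T} {T′} tT (fwd p)) }

  upset : QO n → Fin n → Subset n
  upset T x = tabulate (le T x)

  upset-open : ∀ T → IsTopology T → ∀ x → IsOpen T (upset T x)
  upset-open T (_ , trans-T) x a b a∈ a≤b =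
    ∈-tabulate⁺ (le T x) (trans-T x a b (∈-tabulate⁻ (le T x) a∈) a≤b)

  component : QO n → Fin n → Subset n
  component T = upset (T / T)

  ∈-component⁺ : ∀ {T} → IsTopology T → ∀ {x z} → Linked T x z → z ∈ˢ component T x
  ∈-component⁺ {T} tT {x} xz = ∈-tabulate⁺ (le (T / T) x) (zigzag⇒/ tT xz)

  ∈-component⁻ : ∀ T {x z} → z ∈ˢ component T x → Linked T x z
  ∈-component⁻ T {x} z∈ = /⇒zigzag (∈-tabulate⁻ (le (T / T) x) z∈)

  component-open : ∀ T → IsTopology T → ∀ x → IsOpen T (component T x)
  component-open T tT x a b a∈ a≤b = ∈-component⁺ tT (∈-component⁻ T a∈ ◅◅ fwd a≤b ◅ ε)

  ∁-component-open : ∀ T → IsTopology T → ∀ x → IsOpen T (∁ (component T x))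
  ∁-component-open T tT x a b a∉ a≤b =
    x∉p⇒x∈∁p λ b∈ → x∈∁p⇒x∉p a∉ (∈-component⁺ tT (∈-component⁻ T b∈ ◅◅ bwd a≤b ◅ ε))

  component-connected : ∀ T → IsTopology T → ∀ x → Connected T (component T x)
  component-connected T tT x
    (_ , _ , (Z₁ , Z₁-open , refl) , (Z₂ , Z₂-open , refl) , (u , u∈U) , (v , v∈V) , disjoint , cover) =
    ∉⊥ (subst (v ∈ˢ_) disjoint (x∈p∩q⁺ (spread u∈U (linked-sym (inY u∈U) ◅◅ inY v∈V) , v∈V)))
    where
    Y = component T x

    inY : ∀ {Z p} → p ∈ˢ Z ∩ Y → Linked T x p
    inY {Z} p∈ = ∈-component⁻ T (p∩q⊆q Z Y p∈)

    -- A backward step from Z₁ ∩ Y into Z₂ ∩ Y would put its source in both pieces.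
    step : ∀ {p q} → p ∈ˢ Z₁ ∩ Y → Step T T p q → q ∈ˢ Z₁ ∩ Y
    step p∈U (fwd p≤q) = x∈p∩q⁺ (Z₁-open _ _ (p∩q⊆p Z₁ Y p∈U) p≤q , ∈-component⁺ tT (inY p∈U ◅◅ fwd p≤q ◅ ε))
    step {p} {q} p∈U (bwd q≤p)
      with x∈p∪q⁻ (Z₁ ∩ Y) (Z₂ ∩ Y) (subst (q ∈ˢ_) (sym cover) (∈-component⁺ tT (inY p∈U ◅◅ bwd q≤p ◅ ε)))
    ... | inj₁ q∈U = q∈U
    ... | inj₂ q∈V = ⊥-elim (∉⊥ (subst (p ∈ˢ_) disjoint
                       (x∈p∩q⁺ (p∈U , x∈p∩q⁺ (Z₂-open _ _ (p∩q⊆p Z₂ Y q∈V) q≤p , p∩q⊆q Z₁ Y p∈U)))))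

    spread : ∀ {p q} → p ∈ˢ Z₁ ∩ Y → Linked T p q → q ∈ˢ Z₁ ∩ Y
    spread p∈U ε        = p∈U
    spread p∈U (s ◅ ss) = spread (step p∈U s) ss

  ∩-∁∩-disjoint : ∀ (C Y : Subset n) → (C ∩ Y) ∩ (∁ C ∩ Y) ≡ ⊥
  ∩-∁∩-disjoint C Y = ⊆-antisym
    (λ x∈ → ⊥-elim (x∈∁p⇒x∉p (p∩q⊆p (∁ C) Y (p∩q⊆q (C ∩ Y) _ x∈)) (p∩q⊆p C Y (p∩q⊆p _ _ x∈)))) ⊥⊆

  ∩-∁∩-cover : ∀ (C Y : Subset n) → (C ∩ Y) ∪ (∁ C ∩ Y) ≡ Y
  ∩-∁∩-cover C Y = ⊆-antisym (λ x∈ → [ p∩q⊆q C Y , p∩q⊆q (∁ C) Y ]′ (x∈p∪q⁻ _ _ x∈)) split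
    where
    split : ∀ {x} → x ∈ˢ Y → x ∈ˢ (C ∩ Y) ∪ (∁ C ∩ Y)
    split {x} x∈Y with x ∈ˢ? C
    ... | yes x∈C = x∈p∪q⁺ (inj₁ (x∈p∩q⁺ (x∈C , x∈Y)))
    ... | no  x∉C = x∈p∪q⁺ (inj₂ (x∈p∩q⁺ (x∉p⇒x∈∁p x∉C , x∈Y)))

  connected⇒linked : ∀ {T} → IsTopology T → ∀ {Y} → Connected T Y → ∀ {v w} → v ∈ˢ Y → w ∈ˢ Y → Linked T v w
  connected⇒linked {T} tT {Y} Y-connected {v} {w} v∈Y w∈Y with w ∈ˢ? component T v
  ... | yes w∈C = ∈-component⁻ T w∈C
  ... | no  w∉C = ⊥-elim (Y-connected (C ∩ Y , ∁ C ∩ Y ,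
          (C , component-open T tT v , refl) , (∁ C , ∁-component-open T tT v , refl) ,
          (v , x∈p∩q⁺ (∈-component⁺ {T} tT ε , v∈Y)) , (w , x∈p∩q⁺ (x∉p⇒x∈∁p w∉C , w∈Y)) ,
          ∩-∁∩-disjoint C Y , ∩-∁∩-cover C Y))
    where C = component T v

  upClosure : QO n → Subset n → Subset n
  upClosure T S = tabulate λ w → any (λ v → lookupᵛ S v ∧ le T v w) (allFin n)

  ∈-upClosure⁺ : ∀ T {S v w} → v ∈ˢ S → v ≤[ T ] w → w ∈ˢ upClosure T S
  ∈-upClosure⁺ T {S} {v} {w} v∈S v≤w =
    ∈-tabulate⁺ _ (any-true⁺ (λ u → lookupᵛ S u ∧ le T u w) (∈-allFin v) (∧-true⁺ ([]=⇒lookup v∈S) v≤w))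

  ∈-upClosure⁻ : ∀ T {S w} → w ∈ˢ upClosure T S → ∃ λ v → v ∈ˢ S × v ≤[ T ] w
  ∈-upClosure⁻ T {S} {w} w∈
    with v , h ← any-true⁻ (λ u → lookupᵛ S u ∧ le T u w) (allFin n) (∈-tabulate⁻ _ w∈)
    with v∈S , v≤w ← ∧-true⁻ {lookupᵛ S v} h
    = v , lookup⇒[]= v S v∈S , v≤w

  upClosure-open : ∀ T → IsTopology T → ∀ S → IsOpen T (upClosure T S)
  upClosure-open T (_ , trans-T) S a b a∈ a≤b with v , v∈S , v≤a ← ∈-upClosure⁻ T {S} a∈ =
    ∈-upClosure⁺ T {S} v∈S (trans-T v a b v≤a a≤b)

  record OrderAdmissible (T T′ : QO n) : Set where
    field
      included : ∀ {x y} → x ≤[ T′ ] y → x ≤[ T ] y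
      agrees   : ∀ {x y} → Linked T′ x y → x ≤[ T ] y → x ≤[ T′ ] y
      classes  : ∀ {x y} → Zigzag T T′ x y → Zigzag T T′ y x → Linked T′ x y

    linked⇒zigzag : ∀ {x y} → Linked T′ x y → Zigzag T T′ x y
    linked⇒zigzag = Star.map λ { (fwd p) → fwd (included p) ; (bwd p) → bwd p }

    linked-included : ∀ {x y} → Linked T′ x y → Linked T x y
    linked-included = Star.map λ { (fwd p) → fwd (included p) ; (bwd p) → bwd (included p) }

    zigzag⇒linked : ∀ {x y} → Zigzag T T′ x y → Linked T x y
    zigzag⇒linked = Star.map λ { (fwd p) → fwd p ; (bwd p) → bwd (included p) }

    linked/⇒linked : ∀ {x y} → Linked (T / T′) x y → Linked T x y
    linked/⇒linked xy = xy >>= λ { (fwd p) → zigzag⇒linked (/⇒zigzag p)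
                                 ; (bwd p) → linked-sym (zigzag⇒linked (/⇒zigzag p)) }

  admissible⇒orderAdmissible : ∀ {T T′} → IsTopology T → IsTopology T′ → Admissible T T′ → OrderAdmissible T T′
  admissible⇒orderAdmissible {T} {T′} tT tT′ (T′≺T , sameRestr , sameClasses) = record
    { included = included ; agrees = agrees ; classes = classes }
    where
    included : ∀ {x y} → x ≤[ T′ ] y → x ≤[ T ] y
    included {x} {y} x≤′y =
      ∈-tabulate⁻ (le T x) (T′≺T (upset T x) (upset-open T tT x) x y (∈-tabulate⁺ (le T x) (proj₁ tT x)) x≤′y)

    agrees : ∀ {x y} → Linked T′ x y → x ≤[ T ] y → x ≤[ T′ ] y
    agrees {x} {y} xy x≤y =
      fromRestr (proj₁ (sameRestr C (component-connected T′ tT′ x) (U ∩ C)) (U , upset-open T′ tT′ x , refl))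
      where
      C = component T′ x
      U = upset T′ x
      fromRestr : InRestr T C (U ∩ C) → x ≤[ T′ ] y
      fromRestr (Z , Z-open , Z∩C≡U∩C) =
        ∈-tabulate⁻ (le T′ x) (p∩q⊆p U C (subst (y ∈ˢ_) Z∩C≡U∩C
          (x∈p∩q⁺ (Z-open x y x∈Z x≤y , ∈-component⁺ tT′ xy))))
        where
        x∈Z : x ∈ˢ Z
        x∈Z = p∩q⊆p Z C (subst (x ∈ˢ_) (sym Z∩C≡U∩C)
                (x∈p∩q⁺ (∈-tabulate⁺ (le T′ x) (proj₁ tT′ x) , ∈-component⁺ {T′} tT′ ε)))

    classes : ∀ {x y} → Zigzag T T′ x y → Zigzag T T′ y x → Linked T′ x y
    classes xy yx = /⇒zigzag (proj₁ (proj₁ (sameClasses _ _) (zigzag⇒/ tT xy , zigzag⇒/ tT yx)))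

  orderAdmissible⇒admissible : ∀ {T T′} → IsTopology T → IsTopology T′ → OrderAdmissible T T′ → Admissible T T′
  orderAdmissible⇒admissible {T} {T′} tT tT′ adm = T′≺T , sameRestr , sameClasses
    where
    open OrderAdmissible adm

    T′≺T : T′ ≺ T
    T′≺T U U-open x y x∈U x≤′y = U-open x y x∈U (included x≤′y)

    sameRestr : ∀ Y → Connected T′ Y → SameRestr T′ T Y
    sameRestr Y Y-connected W = toT , fromT
      where
      fromT : InRestr T Y W → InRestr T′ Y W
      fromT (Z , Z-open , Z∩Y≡W) = Z , T′≺T Z Z-open , Z∩Y≡W

      -- Within the T′-connected set Y, T adds nothing to T′, so the T-upward closure of Z ∩ Y works.
      toT : InRestr T′ Y W → InRestr T Y W
      toT (Z , Z-open , Z∩Y≡W) =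
        upClosure T (Z ∩ Y) , upClosure-open T tT (Z ∩ Y) , trans (⊆-antisym shrink grow) Z∩Y≡W
        where
        grow : ∀ {x} → x ∈ˢ Z ∩ Y → x ∈ˢ upClosure T (Z ∩ Y) ∩ Y
        grow x∈ = x∈p∩q⁺ (∈-upClosure⁺ T {Z ∩ Y} x∈ (proj₁ tT _) , p∩q⊆q Z Y x∈)

        shrink : ∀ {x} → x ∈ˢ upClosure T (Z ∩ Y) ∩ Y → x ∈ˢ Z ∩ Y
        shrink {x} x∈ with v , v∈ , v≤x ← ∈-upClosure⁻ T {Z ∩ Y} (p∩q⊆p _ Y x∈) =
          x∈p∩q⁺ (Z-open v x (p∩q⊆p Z Y v∈)
                    (agrees (connected⇒linked tT′ Y-connected (p∩q⊆q Z Y v∈) x∈Y) v≤x) , x∈Y)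
          where x∈Y = p∩q⊆q (upClosure T (Z ∩ Y)) Y x∈

    sameClasses : ∀ x y → (x ∼[ T / T′ ] y) ⟺ (x ∼[ T′ / T′ ] y)
    sameClasses x y =
      (λ (x≤y , y≤x) → let xy = classes (/⇒zigzag x≤y) (/⇒zigzag y≤x) in
                        zigzag⇒/ tT′ xy , zigzag⇒/ tT′ (linked-sym xy)) ,
      (λ (x≤y , y≤x) → zigzag⇒/ tT (linked⇒zigzag (/⇒zigzag x≤y)) , zigzag⇒/ tT (linked⇒zigzag (/⇒zigzag y≤x)))

-- On a cycle x → y → x, every step p → q comes with a way back from q to p.
cycle-map : ∀ {A : Set} {R₁ R₂ S : A → A → Set} →
            (∀ {p q} → R₁ p q → Star R₂ p q) → (∀ {p q} → R₁ p q → Star R₂ q p → S p q) →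
            ∀ {x y} → Star R₁ x y → Star R₂ y x → Star S x y
cycle-map embed convert ε        _  = ε
cycle-map embed convert (r ◅ rs) yx =
  convert r ((rs >>= embed) ◅◅ yx) ◅ cycle-map embed convert rs (yx ◅◅ embed r)

module _ {n : ℕ} {T A a : QO n} (TA : OrderAdmissible T A) (Aa : OrderAdmissible A a) where
  private
    module TA = OrderAdmissible TA
    module Aa = OrderAdmissible Aa

    widen : ∀ {p q} → Step T a p q → Zigzag T A p q
    widen (fwd p≤q) = fwd p≤q ◅ ε
    widen (bwd q≤p) = bwd (Aa.included q≤p) ◅ ε

    -- A T-step inside a class of T / A stays in one A-component, where T and A agree.
    narrow : ∀ {p q} → Step T a p q → Zigzag T A q p → Step A a p q
    narrow (fwd p≤q) qp = fwd (TA.agrees (TA.classes (fwd p≤q ◅ ε) qp) p≤q)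
    narrow (bwd q≤p) _  = bwd q≤p

    cycle⇒zigzag : ∀ {x y} → Zigzag T a x y → Zigzag T A y x → Zigzag A a x y
    cycle⇒zigzag = cycle-map widen narrow

  orderAdmissible-trans : OrderAdmissible T a
  orderAdmissible-trans = record
    { included = TA.included ∘ Aa.included
    ; agrees   = λ xy x≤y → Aa.agrees xy (TA.agrees (Aa.linked-included xy) x≤y)
    ; classes  = λ xy yx → Aa.classes (cycle⇒zigzag xy (yx >>= widen)) (cycle⇒zigzag yx (xy >>= widen))
    }

  module _ (tT : IsTopology T) (tA : IsTopology A) where
    private
      unfold : ∀ {p q} → Step (T / a) (A / a) p q → Zigzag T A p q
      unfold (fwd p≤q) = /⇒zigzag p≤q >>= widen
      unfold (bwd q≤p) = TA.linked⇒zigzag (linked-sym (Aa.zigzag⇒linked (/⇒zigzag q≤p)))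

    /-orderAdmissible : OrderAdmissible (T / a) (A / a)
    /-orderAdmissible = record
      { included = λ p≤q → zigzag⇒/ {T = T} {T′ = a} tT
                             (Star.map (λ { (fwd p) → fwd (TA.included p) ; (bwd p) → bwd p })
                                       (/⇒zigzag {T = A} {T′ = a} p≤q))
      ; agrees   = λ pq p≤q → zigzag⇒/ tA
                     (cycle⇒zigzag (/⇒zigzag p≤q) (TA.linked⇒zigzag (linked-sym (Aa.linked/⇒linked pq))))
      ; classes  = λ xy yx → linked⇒linked/ a tA (TA.classes (xy >>= unfold) (yx >>= unfold))
      }

    /-/ : (T / a) / (A / a) ≡ T / A
    /-/ = ≤-ext (λ p≤q → zigzag⇒/ tT (/⇒zigzag {T = T / a} {T′ = A / a} p≤q >>= unfold))
                (λ p≤q → zigzag⇒/ {T = T / a} {T′ = A / a} (/-isTopology T a tT)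
                           (Star.map (λ { (fwd p) → fwd (step⇒/ {T = T} {T′ = a} tT (fwd p))
                                        ; (bwd p) → bwd (step⇒/ {T = A} {T′ = a} tA (fwd p)) })
                                     (/⇒zigzag {T = T} {T′ = A} p≤q)))

module _ {n : ℕ} where

  restrictToComponents : QO n → QO n → QO n
  restrictToComponents T D = tabulate λ x → tabulate λ y → le T x y ∧ le (D / D) x y

  restrictToComponents⁻ : ∀ T D {x y} → x ≤[ restrictToComponents T D ] y → x ≤[ T ] y × Linked D x y
  restrictToComponents⁻ T D {x} {y} p with x≤y , x~y ← ∧-true⁻ {le T x y} (trans (sym (le-tabulate _ x y)) p) =
    x≤y , /⇒zigzag x~y

  restrictToComponents⁺ : ∀ T D → IsTopology D →
                          ∀ {x y} → x ≤[ T ] y → Linked D x y → x ≤[ restrictToComponents T D ] y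
  restrictToComponents⁺ T D tD {x} {y} x≤y xy = trans (le-tabulate _ x y) (∧-true⁺ x≤y (zigzag⇒/ tD xy))

  restrictToComponents-isTopology : ∀ T D → IsTopology T → IsTopology D → IsTopology (restrictToComponents T D)
  restrictToComponents-isTopology T D (refl-T , trans-T) tD =
    (λ x → restrictToComponents⁺ T D tD (refl-T x) ε) ,
    λ x y z p q → let x≤y , xy = restrictToComponents⁻ T D p ; y≤z , yz = restrictToComponents⁻ T D q in
                  restrictToComponents⁺ T D tD (trans-T x y z x≤y y≤z) (xy ◅◅ yz)

module _ {n : ℕ} {T C D : QO n} (tT : IsTopology T) (tD : IsTopology D)
         (TC : OrderAdmissible T C) (T/C-D : OrderAdmissible (T / C) D) where
  private
    module TC = OrderAdmissible TC
    module T/C-D = OrderAdmissible T/C-D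

    A : QO n
    A = restrictToComponents T D

    A⁻ : ∀ {x y} → x ≤[ A ] y → x ≤[ T ] y × Linked D x y
    A⁻ = restrictToComponents⁻ T D

    A⁺ : ∀ {x y} → x ≤[ T ] y → Linked D x y → x ≤[ A ] y
    A⁺ = restrictToComponents⁺ T D tD

    step/C : ∀ {p q} → Step T C p q → p ≤[ T / C ] q
    step/C = step⇒/ {T = T} {T′ = C} tT

    -- p ≤_C q makes p and q equivalent in T / C, hence D-linked.
    C-edge⇒linked : ∀ {p q} → p ≤[ C ] q → Linked D p q
    C-edge⇒linked p≤q = T/C-D.classes (fwd (step/C (fwd (TC.included p≤q))) ◅ ε) (fwd (step/C (bwd p≤q)) ◅ ε)

    A⊆D : ∀ {x y} → x ≤[ A ] y → x ≤[ D ] y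
    A⊆D p = T/C-D.agrees (proj₂ (A⁻ p)) (step/C (fwd (proj₁ (A⁻ p))))

    C⊆A : ∀ {x y} → x ≤[ C ] y → x ≤[ A ] y
    C⊆A p = A⁺ (TC.included p) (C-edge⇒linked p)

    lift : ∀ {p q} → Step T C p q → Zigzag (T / C) D p q
    lift s = fwd (step/C s) ◅ ε

    -- A T-step inside a class of (T / C) / D joins D-linked points.
    descend : ∀ {p q} → Step T C p q → Zigzag (T / C) D q p → Step A C p q
    descend (fwd p≤q) qp = fwd (A⁺ p≤q (T/C-D.classes (lift (fwd p≤q)) qp))
    descend (bwd q≤p) _  = bwd q≤p

    D⇒zigzag : ∀ {x y} → x ≤[ D ] y → Zigzag A C x y
    D⇒zigzag x≤y = cycle-map lift descend (/⇒zigzag (T/C-D.included x≤y)) (bwd x≤y ◅ ε)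

  restrictToComponents-admissible : OrderAdmissible A C
  restrictToComponents-admissible = record
    { included = C⊆A
    ; agrees   = λ xy x≤y → TC.agrees xy (proj₁ (A⁻ x≤y))
    ; classes  = λ xy yx → TC.classes (Star.map toT xy) (Star.map toT yx)
    }
    where
    toT : ∀ {p q} → Step A C p q → Step T C p q
    toT (fwd p≤q) = fwd (proj₁ (A⁻ p≤q))
    toT (bwd q≤p) = bwd q≤p

  private
    module AC = OrderAdmissible restrictToComponents-admissible

    linkedD⇒linkedA : ∀ {x y} → Linked D x y → Linked A x y
    linkedD⇒linkedA xy = xy >>= λ { (fwd p) → AC.zigzag⇒linked (D⇒zigzag p)
                                  ; (bwd p) → linked-sym (AC.zigzag⇒linked (D⇒zigzag p)) }

  admissible-restrictToComponents : OrderAdmissible T A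
  admissible-restrictToComponents = record
    { included = proj₁ ∘ A⁻
    ; agrees   = λ xy x≤y → A⁺ x≤y (xy >>= λ { (fwd p) → proj₂ (A⁻ p) ; (bwd p) → linked-sym (proj₂ (A⁻ p)) })
    ; classes  = λ xy yx → linkedD⇒linkedA (T/C-D.classes (xy >>= up) (yx >>= up))
    }
    where
    up : ∀ {p q} → Step T A p q → Zigzag (T / C) D p q
    up (fwd p≤q) = fwd (step/C (fwd p≤q)) ◅ ε
    up (bwd q≤p) = bwd (A⊆D q≤p) ◅ ε

  restrictToComponents-/ : A / C ≡ D
  restrictToComponents-/ =
    ≤-ext (λ p → Star.fold (λ x y → x ≤[ D ] y) (λ {x} {y} {z} → proj₂ tD x y z) (proj₁ tD _)
                           (Star.map toD (/⇒zigzag p)))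
          (λ p → zigzag⇒/ (restrictToComponents-isTopology T D tT tD) (D⇒zigzag p))
    where
    toD : ∀ {p q} → Step A C p q → p ≤[ D ] q
    toD (fwd p≤q) = A⊆D p≤q
    toD (bwd q≤p) = T/C-D.agrees (linked-sym (C-edge⇒linked q≤p)) (step/C (bwd q≤p))

  /-restrictToComponents : T / A ≡ (T / C) / D
  /-restrictToComponents =
    ≤-ext (λ p → zigzag⇒/ (/-isTopology T C tT) (Star.map up (/⇒zigzag p)))
          (λ p → zigzag⇒/ tT (/⇒zigzag p >>= down))
    where
    up : ∀ {p q} → Step T A p q → Step (T / C) D p q
    up (fwd p≤q) = fwd (step/C (fwd p≤q))
    up (bwd q≤p) = bwd (A⊆D q≤p)

    down : ∀ {p q} → Step (T / C) D p q → Zigzag T A p q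
    down (fwd p≤q) = Star.map (λ { (fwd p) → fwd p ; (bwd p) → bwd (C⊆A p) }) (/⇒zigzag {T = T} {T′ = C} p≤q)
    down (bwd q≤p) =
      OrderAdmissible.linked⇒zigzag admissible-restrictToComponents (linkedD⇒linkedA (bwd q≤p ◅ ε))

-- x ≤_A y makes x and y equivalent in T / A = T / A′, hence A′-linked, and A′ agrees with T there.
/-injective : ∀ {n} {T A A′ : QO n} → IsTopology T → OrderAdmissible T A → OrderAdmissible T A′ →
              T / A ≡ T / A′ → A ≡ A′
/-injective {T = T} tT TA TA′ eq = ≤-ext (transfer TA TA′ eq) (transfer TA′ TA (sym eq))
  where
  transfer : ∀ {B B′} → OrderAdmissible T B → OrderAdmissible T B′ → T / B ≡ T / B′ →
             ∀ {x y} → x ≤[ B ] y → x ≤[ B′ ] y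
  transfer {B} {B′} TB TB′ eq {x} {y} x≤y =
    TB′.agrees (TB′.classes (/⇒zigzag (along (fwd (TB.included x≤y)))) (/⇒zigzag (along (bwd x≤y))))
               (TB.included x≤y)
    where
    module TB  = OrderAdmissible TB
    module TB′ = OrderAdmissible TB′
    along : ∀ {p q} → Step T B p q → p ≤[ T / B′ ] q
    along {p} {q} s = subst (λ M → p ≤[ M ] q) eq (step⇒/ tT s)

unique-concatMap⁺ : ∀ {A B : Set} (f : A → List B) {xs} → Unique xs → (∀ {x} → x ∈ xs → Unique (f x)) →
                    (∀ {x y z} → x ∈ xs → y ∈ xs → z ∈ f x → z ∈ f y → x ≡ y) → Unique (concatMap f xs)
unique-concatMap⁺ f {[]}     _          _        _        = []
unique-concatMap⁺ f {x ∷ xs} (x∉ ∷ uxs) unique-f disjoint =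
  Unique.++⁺ (unique-f (here refl))
             (unique-concatMap⁺ f uxs (unique-f ∘ there) (λ p q → disjoint (there p) (there q)))
    λ (z∈fx , z∈rest) → let y , y∈xs , z∈fy = find (∈-concatMap⁻ f z∈rest) in
                        All.lookup x∉ y∈xs (disjoint (here refl) (there y∈xs) z∈fx z∈fy)

module _ {A B C : Set} (f : A → List B) (g : A → B → C) where

  ∈-concatMap∘map⁺ : ∀ {xs y w} → y ∈ xs → w ∈ f y → g y w ∈ concatMap (λ y → map (g y) (f y)) xs
  ∈-concatMap∘map⁺ y∈ w∈ = ∈-concatMap⁺ _ (lose y∈ (∈-map⁺ (g _) w∈))

  ∈-concatMap∘map⁻ : ∀ {xs z} → z ∈ concatMap (λ y → map (g y) (f y)) xs →
                     ∃₂ λ y w → y ∈ xs × w ∈ f y × z ≡ g y w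
  ∈-concatMap∘map⁻ z∈ =
    let y , y∈ , z∈y = find (∈-concatMap⁻ _ z∈) ; w , w∈ , z≡ = ∈-map⁻ (g y) z∈y in y , w , y∈ , w∈ , z≡

  unique-concatMap∘map⁺ : ∀ {xs} → Unique xs → (∀ {y} → y ∈ xs → Unique (f y)) →
                          (∀ y {w w′} → g y w ≡ g y w′ → w ≡ w′) →
                          (∀ {y y′ w w′} → y ∈ xs → y′ ∈ xs → w ∈ f y → w′ ∈ f y′ → g y w ≡ g y′ w′ → y ≡ y′) →
                          Unique (concatMap (λ y → map (g y) (f y)) xs)
  unique-concatMap∘map⁺ uxs uf g-injective g-separates =
    unique-concatMap⁺ _ uxs (λ y∈ → Unique.map⁺ (g-injective _) (uf y∈)) λ y∈ y′∈ z∈ z∈′ →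
      let w , w∈ , z≡ = ∈-map⁻ _ z∈ ; w′ , w′∈ , z≡′ = ∈-map⁻ _ z∈′ in
      g-separates y∈ y′∈ w∈ w′∈ (trans (sym z≡) z≡′)

module _ {A : Set} {xs : List A} where

  allVecs-complete : (∀ a → a ∈ xs) → ∀ k (v : Vec A k) → v ∈ allVecs k xs
  allVecs-complete all∈ zero    []      = here refl
  allVecs-complete all∈ (suc k) (a ∷ v) = ∈-concatMap∘map⁺ _ _∷_ (all∈ a) (allVecs-complete all∈ k v)

  allVecs-unique : Unique xs → ∀ k → Unique (allVecs k xs)
  allVecs-unique uxs zero    = All.[] ∷ []
  allVecs-unique uxs (suc k) =
    unique-concatMap∘map⁺ _ _∷_ uxs (λ _ → allVecs-unique uxs k) (λ _ → ∷-injectiveʳ) (λ _ _ _ _ → ∷-injectiveˡ)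

module _ {n : ℕ} where

  ∈-Topologies⁺ : ∀ {T : QO n} → IsTopology T → T ∈ Topologies n
  ∈-Topologies⁺ {T} tT = ∈-filter⁺ isTopology? (allVecs-complete (allVecs-complete bool∈ n) n T) tT
    where
    bool∈ : ∀ b → b ∈ true ∷ false ∷ []
    bool∈ true  = here refl
    bool∈ false = there (here refl)

  ∈-Topologies⁻ : ∀ {T : QO n} → T ∈ Topologies n → IsTopology T
  ∈-Topologies⁻ T∈ = proj₂ (∈-filter⁻ isTopology? {xs = allMatrices n} T∈)

  Topologies-unique : Unique (Topologies n)
  Topologies-unique =
    Unique.filter⁺ isTopology? (allVecs-unique (allVecs-unique (((λ ()) All.∷ All.[]) ∷ All.[] ∷ []) n) n)

module _ {n : ℕ} where

  data ΓSummand (T : QO n) : QO n × QO n → Set where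
    summand : ∀ {T′} → IsTopology T′ → OrderAdmissible T T′ → ΓSummand T (T′ , T / T′)

  data ΓId∘ΓSummand (T : QO n) : QO n × QO n × QO n → Set where
    summand : ∀ {A a} → IsTopology A → OrderAdmissible T A → IsTopology a → OrderAdmissible A a →
              ΓId∘ΓSummand T (a , A / a , T / A)

  data IdΓ∘ΓSummand (T : QO n) : QO n × QO n × QO n → Set where
    summand : ∀ {C D} → IsTopology C → OrderAdmissible T C → IsTopology D → OrderAdmissible (T / C) D →
              IdΓ∘ΓSummand T (C , D , (T / C) / D)

  module _ {T : QO n} (tT : IsTopology T) where

    ∈-Γ⁺ : ∀ {p} → ΓSummand T p → p ∈ Γ T
    ∈-Γ⁺ (summand tT′ TT′) =
      ∈-map⁺ _ (∈-filter⁺ (admissible? T) (∈-Topologies⁺ tT′) (orderAdmissible⇒admissible tT tT′ TT′))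

    ∈-Γ⁻ : ∀ {p} → p ∈ Γ T → ΓSummand T p
    ∈-Γ⁻ p∈ = fromFilter (∈-map⁻ _ p∈)
      where
      fromFilter : ∀ {p} → (∃ λ T′ → T′ ∈ filter (admissible? T) (Topologies n) × p ≡ (T′ , T / T′)) →
                   ΓSummand T p
      fromFilter (T′ , T′∈ , refl) = let T′∈′ , adm = ∈-filter⁻ (admissible? T) {xs = Topologies n} T′∈ in
        summand (∈-Topologies⁻ T′∈′) (admissible⇒orderAdmissible tT (∈-Topologies⁻ T′∈′) adm)

  Γ-unique : ∀ T → Unique (Γ T)
  Γ-unique T = Unique.map⁺ (cong proj₁) (Unique.filter⁺ (admissible? T) (Topologies-unique {n}))

  expandˡ expandʳ : QO n × QO n → QO n × QO n → QO n × QO n × QO n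
  expandˡ (_ , B) (a , b) = a , b , B
  expandʳ (A , _) (b , c) = A , b , c

  module _ {T : QO n} (tT : IsTopology T) where

    ∈-ΓId∘Γ⁺ : ∀ {z} → ΓId∘ΓSummand T z → z ∈ ΓId∘Γ T
    ∈-ΓId∘Γ⁺ (summand tA TA ta Aa) =
      ∈-concatMap∘map⁺ (Γ ∘ proj₁) expandˡ (∈-Γ⁺ tT (summand tA TA)) (∈-Γ⁺ tA (summand ta Aa))

    ∈-ΓId∘Γ⁻ : ∀ {z} → z ∈ ΓId∘Γ T → ΓId∘ΓSummand T z
    ∈-ΓId∘Γ⁻ z∈ = split (∈-concatMap∘map⁻ (Γ ∘ proj₁) expandˡ z∈)
      where
      extend : ∀ {A w} → IsTopology A → OrderAdmissible T A → ΓSummand A w →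
               ΓId∘ΓSummand T (expandˡ (A , T / A) w)
      extend tA TA (summand ta Aa) = summand tA TA ta Aa

      combine : ∀ {y w} → ΓSummand T y → w ∈ Γ (proj₁ y) → ΓId∘ΓSummand T (expandˡ y w)
      combine (summand tA TA) w∈ = extend tA TA (∈-Γ⁻ tA w∈)

      split : ∀ {z} → (∃₂ λ y w → y ∈ Γ T × w ∈ Γ (proj₁ y) × z ≡ expandˡ y w) → ΓId∘ΓSummand T z
      split (y , w , y∈ , w∈ , refl) = combine (∈-Γ⁻ tT y∈) w∈

    ∈-IdΓ∘Γ⁺ : ∀ {z} → IdΓ∘ΓSummand T z → z ∈ IdΓ∘Γ T
    ∈-IdΓ∘Γ⁺ (summand {C} tC TC tD T/C-D) =
      ∈-concatMap∘map⁺ (Γ ∘ proj₂) expandʳ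
        (∈-Γ⁺ tT (summand tC TC)) (∈-Γ⁺ (/-isTopology T C tT) (summand tD T/C-D))

    ∈-IdΓ∘Γ⁻ : ∀ {z} → z ∈ IdΓ∘Γ T → IdΓ∘ΓSummand T z
    ∈-IdΓ∘Γ⁻ z∈ = split (∈-concatMap∘map⁻ (Γ ∘ proj₂) expandʳ z∈)
      where
      extend : ∀ {C w} → IsTopology C → OrderAdmissible T C → ΓSummand (T / C) w →
               IdΓ∘ΓSummand T (expandʳ (C , T / C) w)
      extend tC TC (summand tD T/C-D) = summand tC TC tD T/C-D

      combine : ∀ {y w} → ΓSummand T y → w ∈ Γ (proj₂ y) → IdΓ∘ΓSummand T (expandʳ y w)
      combine (summand {C} tC TC) w∈ = extend tC TC (∈-Γ⁻ (/-isTopology T C tT) w∈)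

      split : ∀ {z} → (∃₂ λ y w → y ∈ Γ T × w ∈ Γ (proj₂ y) × z ≡ expandʳ y w) → IdΓ∘ΓSummand T z
      split (y , w , y∈ , w∈ , refl) = combine (∈-Γ⁻ tT y∈) w∈

    ΓId∘ΓSummand⇒IdΓ∘ΓSummand : ∀ {z} → ΓId∘ΓSummand T z → IdΓ∘ΓSummand T z
    ΓId∘ΓSummand⇒IdΓ∘ΓSummand (summand {A} {a} tA TA ta Aa) =
      subst (λ M → IdΓ∘ΓSummand T (a , A / a , M)) (/-/ TA Aa tT tA)
            (summand ta (orderAdmissible-trans TA Aa) (/-isTopology A a tA) (/-orderAdmissible TA Aa tT tA))

    IdΓ∘ΓSummand⇒ΓId∘ΓSummand : ∀ {z} → IdΓ∘ΓSummand T z → ΓId∘ΓSummand T z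
    IdΓ∘ΓSummand⇒ΓId∘ΓSummand (summand {C} {D} tC TC tD T/C-D) =
      subst₂ (λ X Y → ΓId∘ΓSummand T (C , X , Y))
             (restrictToComponents-/ tT tD TC T/C-D) (/-restrictToComponents tT tD TC T/C-D)
             (summand (restrictToComponents-isTopology T D tT tD) (admissible-restrictToComponents tT tD TC T/C-D)
                      tC (restrictToComponents-admissible tT tD TC T/C-D))

    ∈-ΓId∘Γ⇔∈-IdΓ∘Γ : ∀ {z} → z ∈ ΓId∘Γ T ⇔ z ∈ IdΓ∘Γ T
    ∈-ΓId∘Γ⇔∈-IdΓ∘Γ = mk⇔ (∈-IdΓ∘Γ⁺ ∘ ΓId∘ΓSummand⇒IdΓ∘ΓSummand ∘ ∈-ΓId∘Γ⁻)
                          (∈-ΓId∘Γ⁺ ∘ IdΓ∘ΓSummand⇒ΓId∘ΓSummand ∘ ∈-IdΓ∘Γ⁻)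

    ΓId∘Γ-unique : Unique (ΓId∘Γ T)
    ΓId∘Γ-unique =
      unique-concatMap∘map⁺ (Γ ∘ proj₁) expandˡ (Γ-unique T) (λ {y} _ → Γ-unique (proj₁ y))
        (λ _ eq → cong (λ t → proj₁ t , proj₁ (proj₂ t)) eq)
        λ y∈ y′∈ _ _ eq → separate (∈-Γ⁻ tT y∈) (∈-Γ⁻ tT y′∈) (cong (proj₂ ∘ proj₂) eq)
      where
      separate : ∀ {y y′} → ΓSummand T y → ΓSummand T y′ → proj₂ y ≡ proj₂ y′ → y ≡ y′
      separate (summand _ TA) (summand _ TA′) eq = cong (λ M → M , T / M) (/-injective tT TA TA′ eq)

    IdΓ∘Γ-unique : Unique (IdΓ∘Γ T)
    IdΓ∘Γ-unique =
      unique-concatMap∘map⁺ (Γ ∘ proj₂) expandʳ (Γ-unique T) (λ {y} _ → Γ-unique (proj₂ y))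
        (λ _ eq → cong proj₂ eq)
        λ y∈ y′∈ _ _ eq → separate (∈-Γ⁻ tT y∈) (∈-Γ⁻ tT y′∈) (cong proj₁ eq)
      where
      separate : ∀ {y y′} → ΓSummand T y → ΓSummand T y′ → proj₁ y ≡ proj₁ y′ → y ≡ y′
      separate (summand _ _) (summand _ _) refl = refl

theorem3p1 : (n : ℕ) (T : QO n) → IsTopology T → ΓId∘Γ T ↭ IdΓ∘Γ T
theorem3p1 n T tT =
  ∼bag⇒↭ (unique∧set⇒bag (ΓId∘Γ-unique {T = T} tT) (IdΓ∘Γ-unique {T = T} tT) (∈-ΓId∘Γ⇔∈-IdΓ∘Γ {T = T} tT))
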